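{- Let $M$ be a matroid of rank $d$ with no coloops, and for $0\le i\le d$ let $f_i$ be the number of independent sets of $M$ of size $i$. Then for all $0\le k\le d$, $$0\le \sum_{i=k}^{d}\binom{i}{k}(-2)^{d-i}f_i.$$ -}

module Defs where

open import Data.Bool using (Bool; true; false; T; _∧_)
open import Data.Nat using (ℕ; zero; suc; _+_; _∸_; _<_; _≤_; _≡ᵇ_)
open import Data.Nat.Combinatorics using (_C_)
open import Data.Integer as ℤ using (ℤ; +_; -[1+_])
open import Data.Fin using (Fin)
open import Data.Fin.Subset using (Subset; ⊥; ⁅_⁆; _∪_; _∈_; _∉_; _⊆_; ∣_∣)
open import Data.Vec using (_∷_; [])
open import Data.List using (List; []; _∷_; map; filter; length; foldr; upTo; _++_)
open import Data.Product using (∃; _×_)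
open import Relation.Nullary using (Dec; ¬_)
open import Relation.Nullary.Decidable using (_×-dec_)
open import Relation.Binary.PropositionalEquality using (_≡_)
open import Data.Nat using (_≟_)

-- A (finite) matroid on the ground set Fin n, given by its independent sets.
-- Independence is a decidable predicate (harmless: the ground set is finite).
record Matroid (n : ℕ) : Set₁ where
  field
    Indep    : Subset n → Set
    indep?   : (A : Subset n) → Dec (Indep A)
    indep-∅  : Indep ⊥
    indep-⊆  : ∀ {A B} → A ⊆ B → Indep B → Indep A
    exchange : ∀ {A B} → Indep A → Indep B → ∣ A ∣ < ∣ B ∣ →
               ∃ λ x → x ∈ B × x ∉ A × Indep (A ∪ ⁅ x ⁆)

open Matroid public

HasRank : ∀ {n} → Matroid n → ℕ → Set
HasRank M d = (∃ λ B → Indep M B × ∣ B ∣ ≡ d) × (∀ A → Indep M A → ∣ A ∣ ≤ d)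

IsBasis : ∀ {n} → Matroid n → ℕ → Subset n → Set
IsBasis M d B = Indep M B × ∣ B ∣ ≡ d

IsColoop : ∀ {n} → Matroid n → ℕ → Fin n → Set
IsColoop M d e = ∀ B → IsBasis M d B → e ∈ B

NoColoops : ∀ {n} → Matroid n → ℕ → Set
NoColoops {n} M d = (e : Fin n) → ¬ IsColoop M d e

allSubsets : (n : ℕ) → List (Subset n)
allSubsets zero    = [] ∷ []
allSubsets (suc n) = map (false ∷_) (allSubsets n) ++ map (true ∷_) (allSubsets n)

fvec : ∀ {n} → Matroid n → ℕ → ℕ
fvec {n} M i = length (filter (λ A → indep? M A ×-dec (∣ A ∣ ≟ i)) (allSubsets n))

sumℤ : List ℤ → ℤ
sumℤ = foldr ℤ._+_ (+ 0)

range : ℕ → ℕ → List ℕ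
range k d = map (λ j → k + j) (upTo (suc d ∸ k))

hSum : ∀ {n} → Matroid n → ℕ → ℕ → ℤ
hSum M d k = sumℤ (map (λ i → (+ (i C k)) ℤ.* ((ℤ.- (+ 2)) ℤ.^ (d ∸ i)) ℤ.* (+ fvec M i)) (range k d))

-- Put h_M(x) = Σ_{A independent} (1 + x)^∣A∣ (−2)^(d − ∣A∣); its coefficient of x^k is the sum in the theorem.
-- Deletion–contraction at an element gives h_I = h_{I ∖ x} + (1 + x) h_{I / x}, which at a coloop collapses to
-- a factor x − 1. Let S be the series class of a non-loop e (e together with every f such that each basis meets
-- {e, f}) and m = ∣S∣. Deleting one element of S turns the others into coloops, and induction on m gives
--   h_M = ½((1 + x)^m − (x − 1)^m) h_{M ∖ S} + (1 + x)^m h_{M / S},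
-- where both multipliers have nonnegative coefficients. M ∖ S and M / S are again coloop-free, of ranks
-- d − m + 1 and d − m, and e is a loop in both (h_{M / S} = 0 if S is dependent), so induction on the number
-- of non-loops reduces the theorem to matroids consisting of loops, where d = 0 and h_M = 1.

module Submission where

open import Defs
open import Data.Nat using (ℕ; _≤_)
open import Data.Integer using (+_)
open import Data.Integer using () renaming (_≤_ to _≤ℤ_)

import Data.Nat as ℕ
open import Data.Nat using (zero; suc; _<_; _∸_; z≤n; s≤s; _≤?_)
open import Data.Nat.Properties using () renaming (_≟_ to _≟ℕ_)
open import Data.Nat.Induction using (<-wellFounded)
open import Induction.WellFounded using (Acc; acc)
import Data.Nat.Properties as ℕ
open import Data.Nat.Combinatorics using (_C_; nCk+nC[k+1]≡[n+1]C[k+1]; k>n⇒nCk≡0)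
open import Data.Integer using (ℤ; _+_; _*_; _-_; -_; _^_; +≤+)
import Data.Integer.Properties as ℤ
open import Algebra.Properties.CommutativeSemigroup ℤ.+-commutativeSemigroup using (interchange)
open import Data.Integer.Tactic.RingSolver using (solve-∀)
open import Data.Bool using (true; false; if_then_else_)
open import Data.Fin using (Fin) renaming (zero to fzero; suc to fsuc)
open import Data.Fin using (_≟_)
open import Data.Fin.Properties using (any?)
open import Data.Fin.Subset using (Subset; ⊥; ⁅_⁆; _∪_; _─_; _∈_; _∉_; _⊆_; ∣_∣; Lift; Nonempty; Empty)
open import Data.Fin.Subset.Properties
  using ( _∈?_; Lift?; anySubset?; ∉⊥; x∈⁅x⁆; x∈⁅y⁆⇒x≡y; x∈p∪q⁺; x∈p∪q⁻; p⊆p∪q; q⊆p∪q; p─q⊆p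
        ; x∈p∧x∉q⇒x∈p─q; x∈p∧x≢y⇒x∈p-y; drop-∷-⊆; ⊆-trans; ⊆-antisym; Empty-unique
        ; ∪-assoc; ∪-comm; ∪-identityˡ; ∪-identityʳ; p─q─r≡p─r─q
        ; ∣⊥∣≡0; ∣⁅x⁆∣≡1; p⊂q⇒∣p∣<∣q∣; x∈p⇒∣p-x∣<∣p∣ )
open import Data.Vec using ([]; _∷_; lookup; tabulate; here; there)
open import Data.Vec.Properties using ([]=⇒lookup; lookup⇒[]=; lookup∘tabulate)
open import Data.List using (List; []; _∷_; map; _++_; filter; length; applyUpTo)
import Data.List.Properties as List
open import Data.Product using (∃; _×_; _,_; proj₁; proj₂; map₂)
open import Data.Sum using (_⊎_; inj₁; inj₂)
open import Relation.Nullary using (Dec; yes; no; does; ¬_; ¬?; _×-dec_)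
open import Relation.Nullary.Decidable using (dec-true; decidable-stable; _⊎-dec_)
open import Relation.Binary.PropositionalEquality
open import Relation.Unary using (Pred; Decidable; _≐_)
open import Level using (0ℓ)
open import Function using (case_of_; _∘_)
open import Data.Empty using (⊥-elim)

private
  variable
    X Y : Set
    n d : ℕ
    I : Pred (Subset n) 0ℓ
    S T U : Subset n

-- Finite sums

sumℤ-++ : ∀ xs ys → sumℤ (xs ++ ys) ≡ sumℤ xs + sumℤ ys
sumℤ-++ []       ys = sym (ℤ.+-identityˡ _)
sumℤ-++ (x ∷ xs) ys = trans (cong (_+_ x) (sumℤ-++ xs ys)) (sym (ℤ.+-assoc x _ _))

sumℤ-map-0 : ∀ (xs : List X) → sumℤ (map (λ _ → + 0) xs) ≡ + 0
sumℤ-map-0 []       = refl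
sumℤ-map-0 (x ∷ xs) = cong (_+_ (+ 0)) (sumℤ-map-0 xs)

sumℤ-map-+ : ∀ (F G : X → ℤ) xs →
             sumℤ (map (λ a → F a + G a) xs) ≡ sumℤ (map F xs) + sumℤ (map G xs)
sumℤ-map-+ F G []       = refl
sumℤ-map-+ F G (x ∷ xs) = trans (cong (_+_ (F x + G x)) (sumℤ-map-+ F G xs)) (interchange (F x) (G x) _ _)

sumℤ-map-*ˡ : ∀ c (F : X → ℤ) xs → sumℤ (map (λ a → c * F a) xs) ≡ c * sumℤ (map F xs)
sumℤ-map-*ˡ c F []       = sym (ℤ.*-zeroʳ c)
sumℤ-map-*ˡ c F (x ∷ xs) = trans (cong (_+_ (c * F x)) (sumℤ-map-*ˡ c F xs)) (sym (ℤ.*-distribˡ-+ c (F x) _))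

sumℤ-map-nonneg : ∀ (F : X → ℤ) xs → (∀ a → + 0 ≤ℤ F a) → + 0 ≤ℤ sumℤ (map F xs)
sumℤ-map-nonneg F []       F≥0 = ℤ.≤-refl
sumℤ-map-nonneg F (x ∷ xs) F≥0 = ℤ.+-mono-≤ (F≥0 x) (sumℤ-map-nonneg F xs F≥0)

sumℤ-swap : ∀ (F : X → Y → ℤ) xs ys →
            sumℤ (map (λ a → sumℤ (map (F a) ys)) xs) ≡ sumℤ (map (λ b → sumℤ (map (λ a → F a b) xs)) ys)
sumℤ-swap F []       ys = sym (sumℤ-map-0 ys)
sumℤ-swap F (x ∷ xs) ys = trans (cong (_+_ (sumℤ (map (F x) ys))) (sumℤ-swap F xs ys))
                                (sym (sumℤ-map-+ (F x) _ ys))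

indicator : Dec X → ℤ → ℤ
indicator (yes _) v = v
indicator (no _)  v = + 0

indicator-cong : (d : Dec X) (d′ : Dec Y) → (X → Y) → (Y → X) → ∀ v → indicator d v ≡ indicator d′ v
indicator-cong (yes _) (yes _)  X→Y Y→X v = refl
indicator-cong (yes x) (no ¬y)  X→Y Y→X v = ⊥-elim (¬y (X→Y x))
indicator-cong (no ¬x) (yes y)  X→Y Y→X v = ⊥-elim (¬x (Y→X y))
indicator-cong (no _)  (no _)   X→Y Y→X v = refl

indicator-accept : (d : Dec X) → X → ∀ v → indicator d v ≡ v
indicator-accept (yes _) x  v = refl
indicator-accept (no ¬x) x  v = ⊥-elim (¬x x)

indicator-reject : (d : Dec X) → ¬ X → ∀ v → indicator d v ≡ + 0
indicator-reject (yes x) ¬x v = ⊥-elim (¬x x)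
indicator-reject (no _)  ¬x v = refl

indicator-× : (d : Dec X) (d′ : Dec Y) → ∀ v → indicator (d ×-dec d′) v ≡ indicator d (indicator d′ v)
indicator-× (yes _) (yes _) v = refl
indicator-× (yes _) (no _)  v = refl
indicator-× (no _)  d′      v = refl

indicator-nonneg : (d : Dec X) → ∀ v → (X → + 0 ≤ℤ v) → + 0 ≤ℤ indicator d v
indicator-nonneg (yes x) v v≥0 = v≥0 x
indicator-nonneg (no _)  v v≥0 = ℤ.≤-refl

sumℤ-map-indicator : (d : Dec X) (F : Y → ℤ) (xs : List Y) →
                     sumℤ (map (λ a → indicator d (F a)) xs) ≡ indicator d (sumℤ (map F xs))
sumℤ-map-indicator (yes _) F xs = refl
sumℤ-map-indicator (no _)  F xs = sumℤ-map-0 xs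

-- Finite subsets

Disjoint : Subset n → Subset n → Set
Disjoint A S = Lift (_∉ S) A

disjoint? : (A S : Subset n) → Dec (Disjoint A S)
disjoint? A S = Lift? (λ x → ¬? (x ∈? S)) A

disjoint-⁅⁆ : ∀ {A : Subset n} {x} → x ∉ A → Disjoint A ⁅ x ⁆
disjoint-⁅⁆ x∉A y∈A y∈⁅x⁆ = x∉A (subst (_∈ _) (x∈⁅y⁆⇒x≡y _ y∈⁅x⁆) y∈A)

x∈p─q⇒x∉q : ∀ {x : Fin n} p q → x ∈ p ─ q → x ∉ q
x∈p─q⇒x∉q (true  ∷ p) (false ∷ q) here      ()
x∈p─q⇒x∉q (_     ∷ p) (_     ∷ q) (there x∈) (there x∈q) = x∈p─q⇒x∉q p q x∈ x∈q

disjoint-tail : ∀ {b c} {p q : Subset n} → Disjoint (b ∷ p) (c ∷ q) → Disjoint p q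
disjoint-tail pq x∈p x∈q = pq (there x∈p) (there x∈q)

∣p∪q∣≡∣p∣+∣q∣ : ∀ (p q : Subset n) → Disjoint p q → ∣ p ∪ q ∣ ≡ ∣ p ∣ ℕ.+ ∣ q ∣
∣p∪q∣≡∣p∣+∣q∣ []          []          _  = refl
∣p∪q∣≡∣p∣+∣q∣ (true  ∷ p) (true  ∷ q) pq = ⊥-elim (pq here here)
∣p∪q∣≡∣p∣+∣q∣ (true  ∷ p) (false ∷ q) pq = cong suc (∣p∪q∣≡∣p∣+∣q∣ p q (disjoint-tail pq))
∣p∪q∣≡∣p∣+∣q∣ (false ∷ p) (true  ∷ q) pq =
  trans (cong suc (∣p∪q∣≡∣p∣+∣q∣ p q (disjoint-tail pq))) (sym (ℕ.+-suc ∣ p ∣ ∣ q ∣))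
∣p∪q∣≡∣p∣+∣q∣ (false ∷ p) (false ∷ q) pq = ∣p∪q∣≡∣p∣+∣q∣ p q (disjoint-tail pq)

x∉p⇒∣p∪⁅x⁆∣≡1+∣p∣ : ∀ {x} (p : Subset n) → x ∉ p → ∣ p ∪ ⁅ x ⁆ ∣ ≡ suc ∣ p ∣
x∉p⇒∣p∪⁅x⁆∣≡1+∣p∣ {x = x} p x∉p = begin
  ∣ p ∪ ⁅ x ⁆ ∣         ≡⟨ ∣p∪q∣≡∣p∣+∣q∣ p ⁅ x ⁆ (disjoint-⁅⁆ x∉p) ⟩
  ∣ p ∣ ℕ.+ ∣ ⁅ x ⁆ ∣   ≡⟨ cong (∣ p ∣ ℕ.+_) (∣⁅x⁆∣≡1 x) ⟩
  ∣ p ∣ ℕ.+ 1           ≡⟨ ℕ.+-comm ∣ p ∣ 1 ⟩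
  suc ∣ p ∣             ∎
  where open ≡-Reasoning

x∈p⇒⁅x⁆∪[p─⁅x⁆]≡p : ∀ {x} {p : Subset n} → x ∈ p → ⁅ x ⁆ ∪ (p ─ ⁅ x ⁆) ≡ p
x∈p⇒⁅x⁆∪[p─⁅x⁆]≡p {x = x} {p} x∈p = ⊆-antisym ⊆p p⊆
  where
  ⊆p : ⁅ x ⁆ ∪ (p ─ ⁅ x ⁆) ⊆ p
  ⊆p y∈ with x∈p∪q⁻ ⁅ x ⁆ (p ─ ⁅ x ⁆) y∈
  ... | inj₁ y∈⁅x⁆ = subst (_∈ p) (sym (x∈⁅y⁆⇒x≡y x y∈⁅x⁆)) x∈p
  ... | inj₂ y∈p─x = p─q⊆p p ⁅ x ⁆ y∈p─x
  p⊆ : p ⊆ ⁅ x ⁆ ∪ (p ─ ⁅ x ⁆)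
  p⊆ {y} y∈p with y ≟ x
  ... | yes refl = x∈p∪q⁺ (inj₁ (x∈⁅x⁆ x))
  ... | no  y≢x  = x∈p∪q⁺ (inj₂ (x∈p∧x≢y⇒x∈p-y y∈p y≢x))

x∈p⇒∣p∣≡1+∣p─⁅x⁆∣ : ∀ {x} {p : Subset n} → x ∈ p → ∣ p ∣ ≡ suc ∣ p ─ ⁅ x ⁆ ∣
x∈p⇒∣p∣≡1+∣p─⁅x⁆∣ {x = x} {p} x∈p = begin
  ∣ p ∣                         ≡⟨ cong ∣_∣ (sym (x∈p⇒⁅x⁆∪[p─⁅x⁆]≡p x∈p)) ⟩
  ∣ ⁅ x ⁆ ∪ (p ─ ⁅ x ⁆) ∣       ≡⟨ ∣p∪q∣≡∣p∣+∣q∣ ⁅ x ⁆ _ (λ y∈x y∈p─x → x∈p─q⇒x∉q p ⁅ x ⁆ y∈p─x y∈x) ⟩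
  ∣ ⁅ x ⁆ ∣ ℕ.+ ∣ p ─ ⁅ x ⁆ ∣   ≡⟨ cong (ℕ._+ ∣ p ─ ⁅ x ⁆ ∣) (∣⁅x⁆∣≡1 x) ⟩
  suc ∣ p ─ ⁅ x ⁆ ∣             ∎
  where open ≡-Reasoning

∣p∣≡1+m⇒Nonempty : ∀ {m} (p : Subset n) → ∣ p ∣ ≡ suc m → Nonempty p
∣p∣≡1+m⇒Nonempty (true  ∷ p) _ = fzero , here
∣p∣≡1+m⇒Nonempty (false ∷ p) e = let x , x∈p = ∣p∣≡1+m⇒Nonempty p e in fsuc x , there x∈p

disjoint-∪ : ∀ {A : Subset n} → Disjoint A U → Disjoint T U → Disjoint (A ∪ T) U
disjoint-∪ {U = U} {T} {A} A#U T#U a∪t = case x∈p∪q⁻ A T a∪t of λ where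
  (inj₁ a) → A#U a
  (inj₂ t) → T#U t

x∈p─⁅y⁆⇒x≢y : ∀ {x y : Fin n} {p} → x ∈ p ─ ⁅ y ⁆ → x ≢ y
x∈p─⁅y⁆⇒x≢y {y = y} {p} x∈ refl = x∈p─q⇒x∉q p ⁅ y ⁆ x∈ (x∈⁅x⁆ y)

∪-least : ∀ {A B C : Subset n} → A ⊆ C → B ⊆ C → A ∪ B ⊆ C
∪-least {A = A} {B} A⊆C B⊆C x∈A∪B with x∈p∪q⁻ A B x∈A∪B
... | inj₁ x∈A = A⊆C x∈A
... | inj₂ x∈B = B⊆C x∈B

x∈p⇒⁅x⁆⊆p : ∀ {x} {p : Subset n} → x ∈ p → ⁅ x ⁆ ⊆ p
x∈p⇒⁅x⁆⊆p {x = x} {p} x∈p y∈⁅x⁆ = subst (_∈ p) (sym (x∈⁅y⁆⇒x≡y x y∈⁅x⁆)) x∈p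

∣p∣≡0⇒Empty : ∀ (p : Subset n) → ∣ p ∣ ≡ 0 → Empty p
∣p∣≡0⇒Empty p ∣p∣≡0 (x , x∈p) = ℕ.0≢1+n (trans (sym ∣p∣≡0) (x∈p⇒∣p∣≡1+∣p─⁅x⁆∣ x∈p))

∣p∣≡1⇒p≡⁅x⁆ : ∀ {x} {p : Subset n} → x ∈ p → ∣ p ∣ ≡ 1 → p ≡ ⁅ x ⁆
∣p∣≡1⇒p≡⁅x⁆ {x = x} {p} x∈p ∣p∣≡1 = begin
  p                          ≡⟨ sym (x∈p⇒⁅x⁆∪[p─⁅x⁆]≡p x∈p) ⟩
  ⁅ x ⁆ ∪ (p ─ ⁅ x ⁆)        ≡⟨ cong (⁅ x ⁆ ∪_) (Empty-unique (∣p∣≡0⇒Empty _ p─x-size)) ⟩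
  ⁅ x ⁆ ∪ ⊥                  ≡⟨ ∪-identityʳ ⁅ x ⁆ ⟩
  ⁅ x ⁆                      ∎
  where open ≡-Reasoning
        p─x-size = ℕ.suc-injective (trans (sym (x∈p⇒∣p∣≡1+∣p─⁅x⁆∣ x∈p)) ∣p∣≡1)

q⊆p⇒∣p─q∣+∣q∣≡∣p∣ : ∀ (p q : Subset n) → q ⊆ p → ∣ p ─ q ∣ ℕ.+ ∣ q ∣ ≡ ∣ p ∣
q⊆p⇒∣p─q∣+∣q∣≡∣p∣ []          []          _   = refl
q⊆p⇒∣p─q∣+∣q∣≡∣p∣ (true  ∷ p) (true  ∷ q) q⊆p =
  trans (ℕ.+-suc ∣ p ─ q ∣ ∣ q ∣) (cong suc (q⊆p⇒∣p─q∣+∣q∣≡∣p∣ p q (drop-∷-⊆ q⊆p)))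
q⊆p⇒∣p─q∣+∣q∣≡∣p∣ (false ∷ p) (true  ∷ q) q⊆p with () ← q⊆p here
q⊆p⇒∣p─q∣+∣q∣≡∣p∣ (true  ∷ p) (false ∷ q) q⊆p =
  cong suc (q⊆p⇒∣p─q∣+∣q∣≡∣p∣ p q (drop-∷-⊆ q⊆p))
q⊆p⇒∣p─q∣+∣q∣≡∣p∣ (false ∷ p) (false ∷ q) q⊆p = q⊆p⇒∣p─q∣+∣q∣≡∣p∣ p q (drop-∷-⊆ q⊆p)

module _ {P : Fin n → Set} (P? : Decidable P) where

  x∈tabulate⁺ : ∀ {x} → P x → x ∈ tabulate (does ∘ P?)
  x∈tabulate⁺ {x} px = lookup⇒[]= x _ (trans (lookup∘tabulate (does ∘ P?) x) (dec-true (P? x) px))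

  x∈tabulate⁻ : ∀ {x} → x ∈ tabulate (does ∘ P?) → P x
  x∈tabulate⁻ {x} x∈ with P? x | trans (sym (lookup∘tabulate (does ∘ P?) x)) ([]=⇒lookup x∈)
  ... | yes px | _ = px
  ... | no  _  | ()

∑ : ∀ {n} → (Subset n → ℤ) → ℤ
∑ {n} F = sumℤ (map F (allSubsets n))

∑-∷ : ∀ {n} (F : Subset (suc n) → ℤ) → ∑ F ≡ ∑ (λ A → F (false ∷ A)) + ∑ (λ A → F (true ∷ A))
∑-∷ {n} F = begin
  sumℤ (map F (map (false ∷_) L ++ map (true ∷_) L))
    ≡⟨ cong sumℤ (List.map-++ F (map (false ∷_) L) _) ⟩
  sumℤ (map F (map (false ∷_) L) ++ map F (map (true ∷_) L))
    ≡⟨ sumℤ-++ (map F (map (false ∷_) L)) _ ⟩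
  sumℤ (map F (map (false ∷_) L)) + sumℤ (map F (map (true ∷_) L))
    ≡⟨ sym (cong₂ _+_ (cong sumℤ (List.map-∘ L)) (cong sumℤ (List.map-∘ L))) ⟩
  ∑ (λ A → F (false ∷ A)) + ∑ (λ A → F (true ∷ A))
    ∎
  where open ≡-Reasoning
        L = allSubsets n

∑-pairUp : ∀ {n} (x : Fin n) (F : Subset n → ℤ) →
           ∑ F ≡ ∑ (λ A → if lookup A x then + 0 else F A + F (A ∪ ⁅ x ⁆))
∑-pairUp {suc n} fzero F = begin
  ∑ F                                                      ≡⟨ ∑-∷ F ⟩
  ∑ (λ A → F (false ∷ A)) + ∑ (λ A → F (true ∷ A))         ≡⟨ cong (_+_ (∑ (λ A → F (false ∷ A)))) F[true∷A∪⊥] ⟩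
  ∑ (λ A → F (false ∷ A)) + ∑ (λ A → F (true ∷ (A ∪ ⊥)))   ≡⟨ sym (sumℤ-map-+ (λ A → F (false ∷ A)) _ L) ⟩
  ∑ (λ A → G (false ∷ A))                                  ≡⟨ sym (ℤ.+-identityʳ _) ⟩
  ∑ (λ A → G (false ∷ A)) + + 0                            ≡⟨ cong (_+_ (∑ G₀)) (sym (sumℤ-map-0 L)) ⟩
  ∑ (λ A → G (false ∷ A)) + ∑ (λ A → G (true ∷ A))         ≡⟨ sym (∑-∷ G) ⟩
  ∑ G                                                      ∎
  where open ≡-Reasoning
        L = allSubsets n
        G : Subset (suc n) → ℤ
        G A = if lookup A fzero then + 0 else F A + F (A ∪ ⁅ fzero ⁆)
        G₀ : Subset n → ℤ
        G₀ A = G (false ∷ A)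
        F[true∷A∪⊥] : ∑ (λ A → F (true ∷ A)) ≡ ∑ (λ A → F (true ∷ (A ∪ ⊥)))
        F[true∷A∪⊥] = cong sumℤ (List.map-cong (λ A → cong (λ B → F (true ∷ B)) (sym (∪-identityʳ A))) L)
∑-pairUp {suc n} (fsuc y) F = begin
  ∑ F                                                  ≡⟨ ∑-∷ F ⟩
  ∑ (λ A → F (false ∷ A)) + ∑ (λ A → F (true ∷ A))     ≡⟨ cong₂ _+_ (∑-pairUp y _) (∑-pairUp y _) ⟩
  ∑ (λ A → G (false ∷ A)) + ∑ (λ A → G (true ∷ A))     ≡⟨ sym (∑-∷ G) ⟩
  ∑ G                                                  ∎
  where open ≡-Reasoning
        G : Subset (suc n) → ℤ
        G A = if lookup A (fsuc y) then + 0 else F A + F (A ∪ ⁅ fsuc y ⁆)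

-- Coefficient sequences

Coeffs : Set
Coeffs = ℕ → ℤ

Nonneg : Coeffs → Set
Nonneg p = ∀ k → + 0 ≤ℤ p k

infixl 6 _⊕_
infixr 7 x·_ [1+x]·_ [x-1]·_ [1+x]^_·_ [x-1]^_·_

_⊕_ : Coeffs → Coeffs → Coeffs
(p ⊕ q) k = p k + q k

x·_ : Coeffs → Coeffs
(x· p) zero    = + 0
(x· p) (suc k) = p k

[1+x]·_ : Coeffs → Coeffs
[1+x]· p = p ⊕ x· p

[x-1]·_ : Coeffs → Coeffs
([x-1]· p) k = (x· p) k - p k

[1+x]^_·_ : ℕ → Coeffs → Coeffs
[1+x]^ zero  · p = p
[1+x]^ suc m · p = [1+x]· [1+x]^ m · p

[x-1]^_·_ : ℕ → Coeffs → Coeffs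
[x-1]^ zero  · p = p
[x-1]^ suc m · p = [x-1]· [x-1]^ m · p

-- oddTerms m p = ½((1+x)^m − (x−1)^m)·p  and  evenTerms m p = ½((1+x)^m + (x−1)^m)·p.
oddTerms evenTerms : ℕ → Coeffs → Coeffs
oddTerms  zero    p = λ _ → + 0
oddTerms  (suc m) p = x· oddTerms m p ⊕ evenTerms m p
evenTerms zero    p = p
evenTerms (suc m) p = x· evenTerms m p ⊕ oddTerms m p

x·-cong : ∀ {p q} → p ≗ q → x· p ≗ x· q
x·-cong p≗q zero    = refl
x·-cong p≗q (suc k) = p≗q k

[1+x]·-cong : ∀ {p q} → p ≗ q → [1+x]· p ≗ [1+x]· q
[1+x]·-cong p≗q k = cong₂ _+_ (p≗q k) (x·-cong p≗q k)

[1+x]^-cong : ∀ m {p q} → p ≗ q → [1+x]^ m · p ≗ [1+x]^ m · q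
[1+x]^-cong zero    p≗q = p≗q
[1+x]^-cong (suc m) p≗q = [1+x]·-cong ([1+x]^-cong m p≗q)

[x-1]·-cong : ∀ {p q} → p ≗ q → [x-1]· p ≗ [x-1]· q
[x-1]·-cong p≗q k = cong₂ _-_ (x·-cong p≗q k) (p≗q k)

[x-1]^-cong : ∀ m {p q} → p ≗ q → [x-1]^ m · p ≗ [x-1]^ m · q
[x-1]^-cong zero    p≗q = p≗q
[x-1]^-cong (suc m) p≗q = [x-1]·-cong ([x-1]^-cong m p≗q)

oddTerms-cong  : ∀ m {p q} → p ≗ q → oddTerms m p ≗ oddTerms m q
evenTerms-cong : ∀ m {p q} → p ≗ q → evenTerms m p ≗ evenTerms m q
oddTerms-cong  zero    p≗q k = refl
oddTerms-cong  (suc m) p≗q k = cong₂ _+_ (x·-cong (oddTerms-cong m p≗q) k) (evenTerms-cong m p≗q k)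
evenTerms-cong zero    p≗q k = p≗q k
evenTerms-cong (suc m) p≗q k = cong₂ _+_ (x·-cong (evenTerms-cong m p≗q) k) (oddTerms-cong m p≗q k)

x·-− : ∀ p q k → (x· p) k - (x· q) k ≡ (x· λ j → p j - q j) k
x·-− p q zero    = refl
x·-− p q (suc k) = refl

evenTerms-oddTerms : ∀ m p k → evenTerms m p k - oddTerms m p k ≡ ([x-1]^ m · p) k
evenTerms-oddTerms zero    p k = ℤ.+-identityʳ (p k)
evenTerms-oddTerms (suc m) p k = begin
  (x· E) k + O k - ((x· O) k + E k)            ≡⟨ regroup ((x· E) k) (O k) ((x· O) k) (E k) ⟩
  ((x· E) k - (x· O) k) - (E k - O k)          ≡⟨ cong₂ _-_ (x·-− E O k) (evenTerms-oddTerms m p k) ⟩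
  (x· (λ j → E j - O j)) k - ([x-1]^ m · p) k
    ≡⟨ cong (_- ([x-1]^ m · p) k) (x·-cong (evenTerms-oddTerms m p) k) ⟩
  ([x-1]^ suc m · p) k                         ∎
  where open ≡-Reasoning
        E = evenTerms m p
        O = oddTerms m p
        regroup : ∀ a b c d → a + b - (c + d) ≡ (a - c) - (d - b)
        regroup = solve-∀

oddTerms-suc : ∀ m p → oddTerms (suc m) p ≗ [x-1]^ m · p ⊕ [1+x]· oddTerms m p
oddTerms-suc m p k = begin
  (x· O) k + E k                      ≡⟨ regroup ((x· O) k) (E k) (O k) ⟩
  (E k - O k) + (O k + (x· O) k)      ≡⟨ cong (_+ ([1+x]· O) k) (evenTerms-oddTerms m p k) ⟩
  ([x-1]^ m · p) k + ([1+x]· O) k     ∎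
  where open ≡-Reasoning
        E = evenTerms m p
        O = oddTerms m p
        regroup : ∀ a b c → a + b ≡ (b - c) + (c + a)
        regroup = solve-∀

[1+x]·-⊕ : ∀ p q → [1+x]· (p ⊕ q) ≗ [1+x]· p ⊕ [1+x]· q
[1+x]·-⊕ p q zero    = interchange (p 0) (q 0) (+ 0) (+ 0)
[1+x]·-⊕ p q (suc k) = interchange (p (suc k)) (q (suc k)) (p k) (q k)

⊕-nonneg : ∀ {p q} → Nonneg p → Nonneg q → Nonneg (p ⊕ q)
⊕-nonneg p≥0 q≥0 k = ℤ.+-mono-≤ (p≥0 k) (q≥0 k)

x·-nonneg : ∀ {p} → Nonneg p → Nonneg (x· p)
x·-nonneg p≥0 zero    = ℤ.≤-refl
x·-nonneg p≥0 (suc k) = p≥0 k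

[1+x]·-nonneg : ∀ {p} → Nonneg p → Nonneg ([1+x]· p)
[1+x]·-nonneg p≥0 = ⊕-nonneg p≥0 (x·-nonneg p≥0)

[1+x]^-nonneg : ∀ m {p} → Nonneg p → Nonneg ([1+x]^ m · p)
[1+x]^-nonneg zero    p≥0 = p≥0
[1+x]^-nonneg (suc m) p≥0 = [1+x]·-nonneg ([1+x]^-nonneg m p≥0)

oddTerms-nonneg  : ∀ m {p} → Nonneg p → Nonneg (oddTerms m p)
evenTerms-nonneg : ∀ m {p} → Nonneg p → Nonneg (evenTerms m p)
oddTerms-nonneg  zero    p≥0 k = ℤ.≤-refl
oddTerms-nonneg  (suc m) p≥0   = ⊕-nonneg (x·-nonneg (oddTerms-nonneg m p≥0)) (evenTerms-nonneg m p≥0)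
evenTerms-nonneg zero    p≥0   = p≥0
evenTerms-nonneg (suc m) p≥0   = ⊕-nonneg (x·-nonneg (evenTerms-nonneg m p≥0)) (oddTerms-nonneg m p≥0)

oddTerms-1 : ∀ p → oddTerms 1 p ≗ p
oddTerms-1 p zero    = ℤ.+-identityˡ (p 0)
oddTerms-1 p (suc k) = ℤ.+-identityˡ (p (suc k))

indicator-[1+x]· : (dec : Dec X) (p : Coeffs) → ∀ k →
                   indicator dec (([1+x]· p) k) ≡ ([1+x]· λ j → indicator dec (p j)) k
indicator-[1+x]· (yes _) p k       = refl
indicator-[1+x]· (no _)  p zero    = refl
indicator-[1+x]· (no _)  p (suc k) = refl

∑-[1+x]· : (F : Subset n → Coeffs) → ∀ k →
           ∑ (λ A → ([1+x]· F A) k) ≡ ([1+x]· λ j → ∑ (λ A → F A j)) k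
∑-[1+x]· {n} F zero    = trans (sumℤ-map-+ (λ A → F A 0) (λ _ → + 0) (allSubsets n))
                               (cong (_+_ (∑ (λ A → F A 0))) (sumℤ-map-0 (allSubsets n)))
∑-[1+x]· {n} F (suc k) = sumℤ-map-+ (λ A → F A (suc k)) (λ A → F A k) (allSubsets n)

-- Set families and deletion–contraction

Hereditary : Pred (Subset n) 0ℓ → Set
Hereditary I = ∀ {A B} → A ⊆ B → I B → I A

RankBounded : Pred (Subset n) 0ℓ → ℕ → Set
RankBounded I d = ∀ A → I A → ∣ A ∣ ≤ d

infixl 5 _∖_ _/_ _∖?_ _/?_

_∖_ : Pred (Subset n) 0ℓ → Subset n → Pred (Subset n) 0ℓ
(I ∖ S) A = I A × Disjoint A S

_/_ : Pred (Subset n) 0ℓ → Subset n → Pred (Subset n) 0ℓ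
(I / S) A = Disjoint A S × I (A ∪ S)

_∖?_ : {I : Pred (Subset n) 0ℓ} → Decidable I → ∀ S → Decidable (I ∖ S)
(I? ∖? S) A = I? A ×-dec disjoint? A S

_/?_ : {I : Pred (Subset n) 0ℓ} → Decidable I → ∀ S → Decidable (I / S)
(I? /? S) A = disjoint? A S ×-dec I? (A ∪ S)

weight : ℕ → ℕ → ℕ → ℤ
weight d k i = + (i C k) * (- + 2) ^ (d ∸ i)

-- The coefficients of  Σ_{A ∈ I} (1 + x)^∣A∣ (−2)^(d − ∣A∣).
hCoeffs : {I : Pred (Subset n) 0ℓ} → Decidable I → ℕ → Coeffs
hCoeffs I? d k = ∑ λ A → indicator (I? A) (weight d k ∣ A ∣)

hCoeffs-cong : ∀ {I J : Pred (Subset n) 0ℓ} (I? : Decidable I) (J? : Decidable J) →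
               I ≐ J → ∀ d → hCoeffs I? d ≗ hCoeffs J? d
hCoeffs-cong {n} I? J? (I⊆J , J⊆I) d k =
  cong sumℤ (List.map-cong (λ A → indicator-cong (I? A) (J? A) I⊆J J⊆I _) (allSubsets n))

weight-suc : ∀ d k i → weight d k (suc i) ≡ ([1+x]· λ j → weight (d ∸ 1) j i) k
weight-suc d zero    i rewrite ℕ.∸-+-assoc d 1 i = sym (ℤ.+-identityʳ _)
weight-suc d (suc k) i = begin
  + (suc i C suc k) * pw                          ≡⟨ cong (λ c → + c * pw) (sym (nCk+nC[k+1]≡[n+1]C[k+1] i k)) ⟩
  + (i C k ℕ.+ i C suc k) * pw                    ≡⟨ cong (_* pw) (ℤ.pos-+ (i C k) (i C suc k)) ⟩
  (+ (i C k) + + (i C suc k)) * pw                ≡⟨ ℤ.*-distribʳ-+ pw (+ (i C k)) (+ (i C suc k)) ⟩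
  + (i C k) * pw + + (i C suc k) * pw             ≡⟨ ℤ.+-comm (+ (i C k) * pw) _ ⟩
  + (i C suc k) * pw + + (i C k) * pw             ≡⟨ cong (λ e → + (i C suc k) * pw′ e + + (i C k) * pw′ e)
                                                         (sym (ℕ.∸-+-assoc d 1 i)) ⟩
  ([1+x]· (λ j → weight (d ∸ 1) j i)) (suc k)     ∎
  where open ≡-Reasoning
        pw′ = λ e → (- + 2) ^ e
        pw = pw′ (d ∸ suc i)

weight-lowerRank : ∀ {d i} k → i < d → weight d k i ≡ - + 2 * weight (d ∸ 1) k i
weight-lowerRank {suc d} {i} k (s≤s i≤d) = begin
  + (i C k) * (- + 2) ^ (suc d ∸ i)          ≡⟨ cong (λ e → + (i C k) * (- + 2) ^ e) (ℕ.+-∸-assoc 1 i≤d) ⟩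
  + (i C k) * (- + 2 * (- + 2) ^ (d ∸ i))    ≡⟨ swap (+ (i C k)) ((- + 2) ^ (d ∸ i)) ⟩
  - + 2 * weight d k i                       ∎
  where open ≡-Reasoning
        swap : ∀ a b → a * (- + 2 * b) ≡ - + 2 * (a * b)
        swap = solve-∀

hCoeffs-deletion-contraction : ∀ (I? : Decidable I) (x : Fin n) d →
  hCoeffs I? d ≗ hCoeffs (I? ∖? ⁅ x ⁆) d ⊕ [1+x]· hCoeffs (I? /? ⁅ x ⁆) (d ∸ 1)
hCoeffs-deletion-contraction {n} I? x d k = begin
  ∑ G                                                         ≡⟨ ∑-pairUp x G ⟩
  ∑ (λ A → if lookup A x then + 0 else G A + G (A ∪ ⁅ x ⁆))   ≡⟨ cong sumℤ (List.map-cong pair L) ⟩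
  ∑ (λ A → Del A + ([1+x]· Con A) k)                          ≡⟨ sumℤ-map-+ Del _ L ⟩
  ∑ Del + ∑ (λ A → ([1+x]· Con A) k)                          ≡⟨ cong (_+_ (∑ Del)) (∑-[1+x]· Con k) ⟩
  (hCoeffs (I? ∖? ⁅ x ⁆) d ⊕ [1+x]· hCoeffs (I? /? ⁅ x ⁆) (d ∸ 1)) k ∎
  where
  open ≡-Reasoning
  L = allSubsets n
  G Del : Subset n → ℤ
  G   A = indicator (I? A) (weight d k ∣ A ∣)
  Del A = indicator ((I? ∖? ⁅ x ⁆) A) (weight d k ∣ A ∣)
  Con : Subset n → Coeffs
  Con A j = indicator ((I? /? ⁅ x ⁆) A) (weight (d ∸ 1) j ∣ A ∣)
  contracted : ∀ {A} → x ∉ A → G (A ∪ ⁅ x ⁆) ≡ ([1+x]· Con A) k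
  contracted {A} x∉A = begin
    indicator (I? (A ∪ ⁅ x ⁆)) (weight d k ∣ A ∪ ⁅ x ⁆ ∣)
      ≡⟨ indicator-cong (I? (A ∪ ⁅ x ⁆)) ((I? /? ⁅ x ⁆) A) (disjoint-⁅⁆ x∉A ,_) proj₂ _ ⟩
    indicator ((I? /? ⁅ x ⁆) A) (weight d k ∣ A ∪ ⁅ x ⁆ ∣)
      ≡⟨ cong (λ i → indicator ((I? /? ⁅ x ⁆) A) (weight d k i)) (x∉p⇒∣p∪⁅x⁆∣≡1+∣p∣ A x∉A) ⟩
    indicator ((I? /? ⁅ x ⁆) A) (weight d k (suc ∣ A ∣))
      ≡⟨ cong (indicator ((I? /? ⁅ x ⁆) A)) (weight-suc d k ∣ A ∣) ⟩
    indicator ((I? /? ⁅ x ⁆) A) (([1+x]· λ j → weight (d ∸ 1) j ∣ A ∣) k)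
      ≡⟨ indicator-[1+x]· ((I? /? ⁅ x ⁆) A) _ k ⟩
    ([1+x]· Con A) k
      ∎
  pair : ∀ A → (if lookup A x then + 0 else G A + G (A ∪ ⁅ x ⁆)) ≡ Del A + ([1+x]· Con A) k
  pair A with lookup A x in eq
  ... | true  = sym (cong₂ _+_ (indicator-reject ((I? ∖? ⁅ x ⁆) A) (λ (_ , A#x) → A#x x∈A x∈x) _)
                               (trans (sym (indicator-[1+x]· ((I? /? ⁅ x ⁆) A) _ k))
                                      (indicator-reject ((I? /? ⁅ x ⁆) A) (λ (A#x , _) → A#x x∈A x∈x) _)))
    where x∈A = lookup⇒[]= x A eq
          x∈x = x∈⁅x⁆ x
  ... | false = cong₂ _+_ (indicator-cong (I? A) ((I? ∖? ⁅ x ⁆) A) (_, disjoint-⁅⁆ x∉A) proj₁ _)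
                          (contracted x∉A)
    where x∉A : x ∉ A
          x∉A x∈A = case trans (sym ([]=⇒lookup x∈A)) eq of λ ()

weight-diagonal-nonneg : ∀ d k → + 0 ≤ℤ weight d k d
weight-diagonal-nonneg d k rewrite ℕ.n∸n≡0 d =
  subst (+ 0 ≤ℤ_) (sym (ℤ.*-identityʳ (+ (d C k)))) (+≤+ z≤n)

∖-hereditary : Hereditary I → Hereditary (I ∖ S)
∖-hereditary her A⊆B (B∈I , B#S) = her A⊆B B∈I , λ a → B#S (A⊆B a)

/-hereditary : Hereditary I → Hereditary (I / S)
/-hereditary {S = S} her A⊆B (B#S , B∪S∈I) =
  (λ a → B#S (A⊆B a)) , her (∪-least (λ a → p⊆p∪q S (A⊆B a)) (q⊆p∪q _ S)) B∪S∈I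

/-rankBounded : RankBounded I d → RankBounded (I / S) (d ∸ ∣ S ∣)
/-rankBounded {S = S} bounded A (A#S , A∪S∈I) =
  ℕ.m+n≤o⇒m≤o∸n ∣ A ∣ (subst (_≤ _) (∣p∪q∣≡∣p∣+∣q∣ A S A#S) (bounded (A ∪ S) A∪S∈I))

/⁅x⁆-rankBounded : ∀ {x : Fin n} → RankBounded I d → RankBounded (I / ⁅ x ⁆) (d ∸ 1)
/⁅x⁆-rankBounded {d = d} {x} bounded A A∈I/x =
  subst (λ r → ∣ A ∣ ≤ d ∸ r) (∣⁅x⁆∣≡1 x) (/-rankBounded bounded A A∈I/x)

/⁅x⁆-bound : ∀ {x : Fin n} → RankBounded I d → ∀ {A} → (I / ⁅ x ⁆) A → ∣ A ∣ < d
/⁅x⁆-bound {x = x} bounded {A} (A#x , A∪x∈I) =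
  subst (_≤ _) (x∉p⇒∣p∪⁅x⁆∣≡1+∣p∣ A (λ x∈A → A#x x∈A (x∈⁅x⁆ x))) (bounded (A ∪ ⁅ x ⁆) A∪x∈I)

∖-∖ : (I ∖ T) ∖ U ≐ I ∖ (T ∪ U)
∖-∖ {T = T} {U} =
  (λ ((A∈I , A#T) , A#U) → A∈I , λ a t∪u → case x∈p∪q⁻ T U t∪u of λ where
                                             (inj₁ t) → A#T a t
                                             (inj₂ u) → A#U a u) ,
  (λ (A∈I , A#T∪U) → (A∈I , λ a t → A#T∪U a (p⊆p∪q U t)) , λ a u → A#T∪U a (q⊆p∪q T U u))

/-/ : Disjoint U T → (I / T) / U ≐ I / (T ∪ U)
/-/ {U = U} {T} {I} U#T =
  (λ {A} (A#U , A∪U#T , i) → (λ a t∪u → case x∈p∪q⁻ T U t∪u of λ where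
                                            (inj₁ t) → A∪U#T (p⊆p∪q U a) t
                                            (inj₂ u) → A#U a u) ,
                             subst I (reassoc A) i) ,
  (λ {A} (A#T∪U , i) → (λ a u → A#T∪U a (q⊆p∪q T U u)) ,
                       (λ a∪u t → case x∈p∪q⁻ A U a∪u of λ where
                                    (inj₁ a) → A#T∪U a (p⊆p∪q U t)
                                    (inj₂ u) → U#T u t) ,
                       subst I (sym (reassoc A)) i)
  where reassoc : ∀ A → (A ∪ U) ∪ T ≡ A ∪ (T ∪ U)
        reassoc A = trans (∪-assoc A U T) (cong (A ∪_) (∪-comm U T))

∖-/-comm : Disjoint U T → (I ∖ T) / U ≐ (I / U) ∖ T
∖-/-comm {U = U} U#T =
  (λ (A#U , A∪U∈I , A∪U#T) → (A#U , A∪U∈I) , λ a → A∪U#T (p⊆p∪q U a)) ,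
  (λ ((A#U , A∪U∈I) , A#T) → A#U , A∪U∈I , disjoint-∪ A#T U#T)

hCoeffs-∖⁅x⁆-∖ : ∀ (I? : Decidable I) {S x r r′} → x ∈ S → r ≡ r′ →
                 hCoeffs ((I? ∖? ⁅ x ⁆) ∖? (S ─ ⁅ x ⁆)) r ≗ hCoeffs (I? ∖? S) r′
hCoeffs-∖⁅x⁆-∖ I? {S} {x} {r} x∈S r≡r′ k =
  trans (hCoeffs-cong ((I? ∖? ⁅ x ⁆) ∖? (S ─ ⁅ x ⁆)) (I? ∖? (⁅ x ⁆ ∪ (S ─ ⁅ x ⁆))) ∖-∖ r k)
        (cong₂ (λ T r → hCoeffs (I? ∖? T) r k) (x∈p⇒⁅x⁆∪[p─⁅x⁆]≡p x∈S) r≡r′)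

hCoeffs-/⁅x⁆-/ : ∀ (I? : Decidable I) {S x r r′} → x ∈ S → r ≡ r′ →
                 hCoeffs ((I? /? ⁅ x ⁆) /? (S ─ ⁅ x ⁆)) r ≗ hCoeffs (I? /? S) r′
hCoeffs-/⁅x⁆-/ {I = I} I? {S} {x} {r} x∈S r≡r′ k =
  trans (hCoeffs-cong ((I? /? ⁅ x ⁆) /? (S ─ ⁅ x ⁆)) (I? /? (⁅ x ⁆ ∪ (S ─ ⁅ x ⁆)))
                      (/-/ {I = I} (x∈p─q⇒x∉q S ⁅ x ⁆)) r k)
        (cong₂ (λ T r → hCoeffs (I? /? T) r k) (x∈p⇒⁅x⁆∪[p─⁅x⁆]≡p x∈S) r≡r′)

hCoeffs-lowerRank : ∀ (I? : Decidable I) d → (∀ {A} → I A → ∣ A ∣ < d) →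
                    ∀ k → hCoeffs I? d k ≡ - + 2 * hCoeffs I? (d ∸ 1) k
hCoeffs-lowerRank {n} I? d small k =
  trans (cong sumℤ (List.map-cong lower (allSubsets n))) (sumℤ-map-*ˡ (- + 2) _ (allSubsets n))
  where lower : ∀ A → indicator (I? A) (weight d k ∣ A ∣) ≡ - + 2 * indicator (I? A) (weight (d ∸ 1) k ∣ A ∣)
        lower A with I? A
        ... | yes A∈I = weight-lowerRank k (small A∈I)
        ... | no  _   = sym (ℤ.*-zeroʳ (- + 2))

-- Coloops and series classes

Coloops : Pred (Subset n) 0ℓ → Subset n → Set
Coloops I S = ∀ {A T} → T ⊆ S → I A → I (A ∪ T)

∖-coloops : Coloops I S → Coloops (I ∖ U) (S ─ U)
∖-coloops {S = S} {U = U} col {A} {T} T⊆S─U (A∈I , A#U) =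
  col (λ t → p─q⊆p S U (T⊆S─U t)) A∈I ,
  λ a∪t u → case x∈p∪q⁻ A T a∪t of λ where
              (inj₁ a) → A#U a u
              (inj₂ t) → x∈p─q⇒x∉q S U (T⊆S─U t) u

/-coloops : Coloops I S → Coloops (I / U) (S ─ U)
/-coloops {I = I} {S = S} {U = U} col {A} {T} T⊆S─U (A#U , A∪U∈I) =
  disjoint-∪ A#U (λ t → x∈p─q⇒x∉q S U (T⊆S─U t)) ,
  subst I (reorder A) (col (λ t → p─q⊆p S U (T⊆S─U t)) A∪U∈I)
  where reorder : ∀ A → (A ∪ U) ∪ T ≡ (A ∪ T) ∪ U
        reorder A = trans (∪-assoc A U T) (trans (cong (A ∪_) (∪-comm U T)) (sym (∪-assoc A T U)))

coloops-resp-≐ : ∀ {J : Pred (Subset n) 0ℓ} → I ≐ J → Coloops I S → Coloops J S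
coloops-resp-≐ (I⊆J , J⊆I) col T⊆S A∈J = I⊆J (col T⊆S (J⊆I A∈J))

coloop-/≐∖ : ∀ {y} → Hereditary I → Coloops I S → y ∈ S → I / ⁅ y ⁆ ≐ I ∖ ⁅ y ⁆
coloop-/≐∖ {S = S} {y} her col y∈S =
  (λ (A#y , A∪y∈I) → her (p⊆p∪q ⁅ y ⁆) A∪y∈I , A#y) ,
  (λ (A∈I , A#y) → A#y , col (x∈p⇒⁅x⁆⊆p y∈S) A∈I)

-- At a coloop y, I / ⁅ y ⁆ = I ∖ ⁅ y ⁆, and the rank bound lets us lower d at the cost of a factor −2,
-- so deletion–contraction contributes −2 + (1 + x) = x − 1.
hCoeffs-coloops : ∀ m (I? : Decidable I) d → Hereditary I → RankBounded I d → Coloops I S →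
                  ∣ S ∣ ≡ m → hCoeffs I? d ≗ [x-1]^ m · hCoeffs (I? ∖? S) (d ∸ m)
hCoeffs-coloops {S = S} zero I? d her bounded col ∣S∣≡0 =
  hCoeffs-cong I? (I? ∖? S) ((λ A∈I → A∈I , λ _ s → ∣p∣≡0⇒Empty S ∣S∣≡0 (_ , s)) , proj₁) d
hCoeffs-coloops {I = I} {S = S} (suc m) I? d her bounded col ∣S∣≡1+m k = begin
  hCoeffs I? d k                                                       ≡⟨ hCoeffs-deletion-contraction I? y d k ⟩
  hCoeffs (I? ∖? ⁅ y ⁆) d k + ([1+x]· hCoeffs (I? /? ⁅ y ⁆) (d ∸ 1)) k
    ≡⟨ cong₂ _+_ lowered ([1+x]·-cong coloop k) ⟩
  - + 2 * q k + ([1+x]· q) k                                           ≡⟨ regroup (q k) ((x· q) k) ⟩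
  ([x-1]· q) k                                                         ≡⟨ [x-1]·-cong remaining k ⟩
  ([x-1]^ suc m · hCoeffs (I? ∖? S) (d ∸ suc m)) k                     ∎
  where
  open ≡-Reasoning
  y   = proj₁ (∣p∣≡1+m⇒Nonempty S ∣S∣≡1+m)
  y∈S = proj₂ (∣p∣≡1+m⇒Nonempty S ∣S∣≡1+m)
  q   = hCoeffs (I? ∖? ⁅ y ⁆) (d ∸ 1)
  /≐∖ = coloop-/≐∖ her col y∈S
  lowered : hCoeffs (I? ∖? ⁅ y ⁆) d k ≡ - + 2 * q k
  lowered = hCoeffs-lowerRank (I? ∖? ⁅ y ⁆) d (λ A∈I∖y → /⁅x⁆-bound bounded (proj₂ /≐∖ A∈I∖y)) k
  coloop : hCoeffs (I? /? ⁅ y ⁆) (d ∸ 1) ≗ q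
  coloop = hCoeffs-cong (I? /? ⁅ y ⁆) (I? ∖? ⁅ y ⁆) /≐∖ (d ∸ 1)
  remaining : q ≗ [x-1]^ m · hCoeffs (I? ∖? S) (d ∸ suc m)
  remaining j = trans
    (hCoeffs-coloops {S = S ─ ⁅ y ⁆} m (I? ∖? ⁅ y ⁆) (d ∸ 1) (∖-hereditary her)
                     (λ A A∈I∖y → /⁅x⁆-rankBounded bounded A (proj₂ /≐∖ A∈I∖y)) (∖-coloops {I = I} col)
                     (ℕ.suc-injective (trans (sym (x∈p⇒∣p∣≡1+∣p─⁅x⁆∣ y∈S)) ∣S∣≡1+m)) j)
    ([x-1]^-cong m (hCoeffs-∖⁅x⁆-∖ I? y∈S (ℕ.∸-+-assoc d 1 m)) j)
  regroup : ∀ a b → - + 2 * a + (a + b) ≡ b - a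
  regroup = solve-∀

SeriesClass : Pred (Subset n) 0ℓ → Subset n → Set
SeriesClass I S = ∀ {x} → x ∈ S → Coloops (I ∖ ⁅ x ⁆) (S ─ ⁅ x ⁆)

/-seriesClass : ∀ {x} → SeriesClass I S → x ∈ S → SeriesClass (I / ⁅ x ⁆) (S ─ ⁅ x ⁆)
/-seriesClass {I = I} {S = S} {x} series x∈S {z} z∈S─x =
  subst (Coloops ((I / ⁅ x ⁆) ∖ ⁅ z ⁆)) (p─q─r≡p─r─q S ⁅ z ⁆ ⁅ x ⁆)
        (coloops-resp-≐ (∖-/-comm {T = ⁅ z ⁆} {I = I} (disjoint-⁅⁆ z∉⁅x⁆))
                        (/-coloops {I = I ∖ ⁅ z ⁆} {U = ⁅ x ⁆} (series (p─q⊆p S ⁅ x ⁆ z∈S─x))))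
  where z∉⁅x⁆ : z ∉ ⁅ x ⁆
        z∉⁅x⁆ z∈⁅x⁆ = x∈p─⁅y⁆⇒x≢y z∈S─x (x∈⁅y⁆⇒x≡y x z∈⁅x⁆)

-- Deleting z ∈ S ─ ⁅ x ⁆ makes x a coloop; this puts x back into every member of I ∖ S.
seriesClass-/∖ : ∀ {x z} → Hereditary I → SeriesClass I S → x ∈ S → z ∈ S ─ ⁅ x ⁆ →
                 (I / ⁅ x ⁆) ∖ (S ─ ⁅ x ⁆) ≐ I ∖ S
seriesClass-/∖ {S = S} {x} {z} her series x∈S z∈S─x =
  (λ {A} ((A#x , A∪x∈I) , A#S─x) → her (p⊆p∪q ⁅ x ⁆) A∪x∈I ,
     λ {y} y∈A y∈S → case y ≟ x of λ where
       (yes refl) → A#x y∈A (x∈⁅x⁆ x)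
       (no  y≢x)  → A#S─x y∈A (x∈p∧x≢y⇒x∈p-y y∈S y≢x)) ,
  (λ {A} (A∈I , A#S) → (disjoint-⁅⁆ (λ x∈A → A#S x∈A x∈S) ,
                        proj₁ (series (p─q⊆p S ⁅ x ⁆ z∈S─x) x∈S─z (A∈I , A#z A#S))) ,
                       λ a s → A#S a (p─q⊆p S ⁅ x ⁆ s))
  where
  x∈S─z : ⁅ x ⁆ ⊆ S ─ ⁅ z ⁆
  x∈S─z y∈x = x∈p∧x≢y⇒x∈p-y (x∈p⇒⁅x⁆⊆p x∈S y∈x)
                (λ y≡z → x∈p─⁅y⁆⇒x≢y z∈S─x (trans (sym y≡z) (x∈⁅y⁆⇒x≡y x y∈x)))
  A#z : ∀ {A} → Disjoint A S → Disjoint A ⁅ z ⁆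
  A#z A#S a z′ = A#S a (x∈p⇒⁅x⁆⊆p (p─q⊆p S ⁅ x ⁆ z∈S─x) z′)

-- Deletion–contraction at x ∈ S: the rest of S are coloops of I ∖ ⁅ x ⁆ and a series class of I / ⁅ x ⁆.
hCoeffs-seriesClass : ∀ s (I? : Decidable I) d → Hereditary I → RankBounded I d → SeriesClass I S →
                      ∣ S ∣ ≡ suc s →
                      hCoeffs I? d ≗ oddTerms (suc s) (hCoeffs (I? ∖? S) (d ∸ s))
                                     ⊕ [1+x]^ suc s · hCoeffs (I? /? S) (d ∸ suc s)
hCoeffs-seriesClass {S = S} zero I? d her bounded series ∣S∣≡1 k = begin
  hCoeffs I? d k
    ≡⟨ hCoeffs-deletion-contraction I? x d k ⟩
  (hCoeffs (I? ∖? ⁅ x ⁆) d ⊕ [1+x]· hCoeffs (I? /? ⁅ x ⁆) (d ∸ 1)) k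
    ≡⟨ cong (λ T → (hCoeffs (I? ∖? T) d ⊕ [1+x]· hCoeffs (I? /? T) (d ∸ 1)) k) (sym (∣p∣≡1⇒p≡⁅x⁆ x∈S ∣S∣≡1)) ⟩
  (K ⊕ [1+x]· L) k
    ≡⟨ cong (_+ ([1+x]· L) k) (sym (oddTerms-1 K k)) ⟩
  (oddTerms 1 K ⊕ [1+x]· L) k
    ∎
  where open ≡-Reasoning
        x   = proj₁ (∣p∣≡1+m⇒Nonempty S ∣S∣≡1)
        x∈S = proj₂ (∣p∣≡1+m⇒Nonempty S ∣S∣≡1)
        K   = hCoeffs (I? ∖? S) d
        L   = hCoeffs (I? /? S) (d ∸ 1)
hCoeffs-seriesClass {S = S} (suc s) I? d her bounded series ∣S∣≡2+s k = begin
  hCoeffs I? d k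
    ≡⟨ hCoeffs-deletion-contraction I? x d k ⟩
  hCoeffs (I? ∖? ⁅ x ⁆) d k + ([1+x]· hCoeffs (I? /? ⁅ x ⁆) (d ∸ 1)) k
    ≡⟨ cong₂ _+_ deletionTerm ([1+x]·-cong contractionTerm k) ⟩
  ([x-1]^ suc s · K) k + ([1+x]· (oddTerms (suc s) K ⊕ [1+x]^ suc s · L)) k
    ≡⟨ cong (_+_ (([x-1]^ suc s · K) k)) ([1+x]·-⊕ (oddTerms (suc s) K) _ k) ⟩
  ([x-1]^ suc s · K) k + (([1+x]· oddTerms (suc s) K) k + ([1+x]^ suc (suc s) · L) k)
    ≡⟨ sym (ℤ.+-assoc (([x-1]^ suc s · K) k) _ _) ⟩
  ([x-1]^ suc s · K) k + ([1+x]· oddTerms (suc s) K) k + ([1+x]^ suc (suc s) · L) k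
    ≡⟨ cong (_+ ([1+x]^ suc (suc s) · L) k) (sym (oddTerms-suc (suc s) K k)) ⟩
  (oddTerms (suc (suc s)) K ⊕ [1+x]^ suc (suc s) · L) k
    ∎
  where
  open ≡-Reasoning
  x         = proj₁ (∣p∣≡1+m⇒Nonempty S ∣S∣≡2+s)
  x∈S       = proj₂ (∣p∣≡1+m⇒Nonempty S ∣S∣≡2+s)
  ∣S─x∣≡1+s = ℕ.suc-injective (trans (sym (x∈p⇒∣p∣≡1+∣p─⁅x⁆∣ x∈S)) ∣S∣≡2+s)
  z∈S─x     = proj₂ (∣p∣≡1+m⇒Nonempty (S ─ ⁅ x ⁆) ∣S─x∣≡1+s)
  K = hCoeffs (I? ∖? S) (d ∸ suc s)
  L = hCoeffs (I? /? S) (d ∸ suc (suc s))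
  deletionTerm : hCoeffs (I? ∖? ⁅ x ⁆) d k ≡ ([x-1]^ suc s · K) k
  deletionTerm = trans
    (hCoeffs-coloops (suc s) (I? ∖? ⁅ x ⁆) d (∖-hereditary her) (λ A → bounded A ∘ proj₁)
                     (series x∈S) ∣S─x∣≡1+s k)
    ([x-1]^-cong (suc s) (hCoeffs-∖⁅x⁆-∖ I? x∈S refl) k)
  contractionTerm : hCoeffs (I? /? ⁅ x ⁆) (d ∸ 1) ≗ oddTerms (suc s) K ⊕ [1+x]^ suc s · L
  contractionTerm j = trans
    (hCoeffs-seriesClass s (I? /? ⁅ x ⁆) (d ∸ 1) (/-hereditary her) (/⁅x⁆-rankBounded bounded)
                         (/-seriesClass series x∈S) ∣S─x∣≡1+s j)
    (cong₂ _+_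
      (oddTerms-cong (suc s) (λ i → trans
        (hCoeffs-cong ((I? /? ⁅ x ⁆) ∖? (S ─ ⁅ x ⁆)) (I? ∖? S) (seriesClass-/∖ her series x∈S z∈S─x) _ i)
        (cong (λ r → hCoeffs (I? ∖? S) r i) (ℕ.∸-+-assoc d 1 s))) j)
      ([1+x]^-cong (suc s) (hCoeffs-/⁅x⁆-/ I? x∈S (ℕ.∸-+-assoc d 1 (suc s))) j))

-- Matroids

augment : (M : Matroid n) {A B : Subset n} → Indep M A → Indep M B → ∣ A ∣ ≤ ∣ B ∣ →
          ∃ λ D → Indep M D × A ⊆ D × D ⊆ A ∪ B × ∣ D ∣ ≡ ∣ B ∣
augment M {A} {B} A∈I B∈I ∣A∣≤∣B∣ = go (∣ B ∣ ∸ ∣ A ∣) A∈I (ℕ.m∸n+n≡m ∣A∣≤∣B∣)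
  where
  go : ∀ m {A} → Indep M A → m ℕ.+ ∣ A ∣ ≡ ∣ B ∣ → ∃ λ D → Indep M D × A ⊆ D × D ⊆ A ∪ B × ∣ D ∣ ≡ ∣ B ∣
  go zero    {A} A∈I ∣A∣≡∣B∣ = A , A∈I , (λ a → a) , p⊆p∪q B , ∣A∣≡∣B∣
  go (suc m) {A} A∈I m+∣A∣≡∣B∣
    with x , x∈B , x∉A , A∪x∈I ← exchange M A∈I B∈I (subst (∣ A ∣ <_) m+∣A∣≡∣B∣ (s≤s (ℕ.m≤n+m ∣ A ∣ m)))
    with D , D∈I , A∪x⊆D , D⊆A∪x∪B , ∣D∣≡∣B∣ ← go m A∪x∈I
           (trans (cong (m ℕ.+_) (x∉p⇒∣p∪⁅x⁆∣≡1+∣p∣ A x∉A)) (trans (ℕ.+-suc m ∣ A ∣) m+∣A∣≡∣B∣))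
    = D , D∈I , (λ a → A∪x⊆D (p⊆p∪q ⁅ x ⁆ a)) , ⊆-trans D⊆A∪x∪B A∪x∪B⊆A∪B , ∣D∣≡∣B∣
    where A∪x∪B⊆A∪B : (A ∪ ⁅ x ⁆) ∪ B ⊆ A ∪ B
          A∪x∪B⊆A∪B = ∪-least (∪-least (p⊆p∪q B) (⊆-trans (x∈p⇒⁅x⁆⊆p x∈B) (q⊆p∪q A B))) (q⊆p∪q A B)

deletion : Matroid n → Subset n → Matroid n
deletion M S = record
  { Indep    = Indep M ∖ S
  ; indep?   = indep? M ∖? S
  ; indep-∅  = indep-∅ M , λ x∈⊥ → ⊥-elim (∉⊥ x∈⊥)
  ; indep-⊆  = ∖-hereditary (indep-⊆ M)
  ; exchange = λ (A∈I , A#S) (B∈I , B#S) ∣A∣<∣B∣ →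
      let x , x∈B , x∉A , A∪x∈I = exchange M A∈I B∈I ∣A∣<∣B∣
      in  x , x∈B , x∉A , A∪x∈I , disjoint-∪ A#S (λ y∈x → B#S (x∈p⇒⁅x⁆⊆p x∈B y∈x))
  }

contraction : (M : Matroid n) (S : Subset n) → Indep M S → Matroid n
contraction M S S∈I = record
  { Indep    = Indep M / S
  ; indep?   = indep? M /? S
  ; indep-∅  = (λ x∈⊥ → ⊥-elim (∉⊥ x∈⊥)) , subst (Indep M) (sym (∪-identityˡ S)) S∈I
  ; indep-⊆  = /-hereditary (indep-⊆ M)
  ; exchange = exchange/
  }
  where
  exchange/ : ∀ {A B} → (Indep M / S) A → (Indep M / S) B → ∣ A ∣ < ∣ B ∣ →
              ∃ λ x → x ∈ B × x ∉ A × (Indep M / S) (A ∪ ⁅ x ⁆)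
  exchange/ {A} {B} (A#S , A∪S∈I) (B#S , B∪S∈I) ∣A∣<∣B∣
    with x , x∈B∪S , x∉A∪S , A∪S∪x∈I ← exchange M A∪S∈I B∪S∈I
           (subst₂ _<_ (sym (∣p∪q∣≡∣p∣+∣q∣ A S A#S)) (sym (∣p∪q∣≡∣p∣+∣q∣ B S B#S))
                       (ℕ.+-monoˡ-< ∣ S ∣ ∣A∣<∣B∣))
    = x , x∈B , (λ x∈A → x∉A∪S (p⊆p∪q S x∈A)) ,
      disjoint-∪ A#S (λ y∈x → B#S (x∈p⇒⁅x⁆⊆p x∈B y∈x)) , subst (Indep M) (reorder A) A∪S∪x∈I
    where
    x∈B : x ∈ B
    x∈B = case x∈p∪q⁻ B S x∈B∪S of λ where
      (inj₁ x∈B) → x∈B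
      (inj₂ x∈S) → ⊥-elim (x∉A∪S (q⊆p∪q A S x∈S))
    reorder : ∀ A → (A ∪ S) ∪ ⁅ x ⁆ ≡ (A ∪ ⁅ x ⁆) ∪ S
    reorder A = trans (∪-assoc A S ⁅ x ⁆)
                      (trans (cong (A ∪_) (∪-comm S ⁅ x ⁆)) (sym (∪-assoc A ⁅ x ⁆ S)))

Coloopless : Matroid n → ℕ → Set
Coloopless {n} M d = (f : Fin n) → ∃ λ B → IsBasis M d B × f ∉ B

noColoops⇒coloopless : (M : Matroid n) → NoColoops M d → Coloopless M d
noColoops⇒coloopless {d = d} M noColoops f
  with anySubset? (λ B → (indep? M B ×-dec (∣ B ∣ ℕ.≟ d)) ×-dec ¬? (f ∈? B))
... | yes (B , B-basis , f∉B) = B , B-basis , f∉B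
... | no  ∄B =
  ⊥-elim (noColoops f λ B B-basis → decidable-stable (f ∈? B) (λ f∉B → ∄B (B , B-basis , f∉B)))

nonLoop? : (M : Matroid n) → Decidable (λ f → Indep M ⁅ f ⁆)
nonLoop? M f = indep? M ⁅ f ⁆

nonLoops : Matroid n → Subset n
nonLoops M = tabulate (does ∘ nonLoop? M)

nonLoops-shrink : (M′ M : Matroid n) → (∀ {f} → Indep M′ ⁅ f ⁆ → Indep M ⁅ f ⁆) →
                  ∀ {e} → Indep M ⁅ e ⁆ → ¬ Indep M′ ⁅ e ⁆ → ∣ nonLoops M′ ∣ < ∣ nonLoops M ∣
nonLoops-shrink M′ M M′⇒M {e} e∈M e∉M′ =
  p⊂q⇒∣p∣<∣q∣ ( (λ f∈ → x∈tabulate⁺ (nonLoop? M) (M′⇒M (x∈tabulate⁻ (nonLoop? M′) f∈)))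
              , e , x∈tabulate⁺ (nonLoop? M) e∈M , (λ e∈ → e∉M′ (x∈tabulate⁻ (nonLoop? M′) e∈)) )

module SeriesClassOf (M : Matroid n) (d : ℕ) (bounded : RankBounded (Indep M) d)
                     (coloopless : Coloopless M d) (e : Fin n) where

  AvoidedWith : Fin n → Set
  AvoidedWith f = ∃ λ B → IsBasis M d B × e ∉ B × f ∉ B

  avoidedWith? : Decidable AvoidedWith
  avoidedWith? f =
    anySubset? λ B → (indep? M B ×-dec (∣ B ∣ ℕ.≟ d)) ×-dec (¬? (e ∈? B) ×-dec ¬? (f ∈? B))

  InSeries : Fin n → Set
  InSeries f = f ≡ e ⊎ ¬ AvoidedWith f

  inSeries? : Decidable InSeries
  inSeries? f = (f ≟ e) ⊎-dec ¬? (avoidedWith? f)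

  Sₑ : Subset n
  Sₑ = tabulate (does ∘ inSeries?)

  e∈Sₑ : e ∈ Sₑ
  e∈Sₑ = x∈tabulate⁺ inSeries? (inj₁ refl)

  ∈Sₑ⇒InSeries : ∀ {f} → f ∈ Sₑ → InSeries f
  ∈Sₑ⇒InSeries = x∈tabulate⁻ inSeries?

  -- Exchanging e out of a basis B ∋ e gives a basis D ∌ e, which must contain every element in series with e
  -- that B misses; as ∣D ─ B∣ = 1 there is at most one such element.
  missedInSeries-unique : ∀ {B f g} → IsBasis M d B → ¬ AvoidedWith f → ¬ AvoidedWith g →
                          f ∉ B → g ∉ B → f ≡ g
  missedInSeries-unique {B} {f} {g} (B∈I , ∣B∣≡d) ¬f ¬g f∉B g∉B with e ∈? B
  ... | no  e∉B = ⊥-elim (¬f (B , (B∈I , ∣B∣≡d) , e∉B , f∉B))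
  ... | yes e∈B
    with B₀ , (B₀∈I , ∣B₀∣≡d) , e∉B₀ ← coloopless e
    with y , y∈B₀ , y∉B─e , D∈I ← exchange M (indep-⊆ M (p─q⊆p B ⁅ e ⁆) B∈I) B₀∈I
                                    (subst₂ _<_ refl (trans ∣B∣≡d (sym ∣B₀∣≡d)) (x∈p⇒∣p-x∣<∣p∣ e∈B))
    = trans (isY ¬f f∉B) (sym (isY ¬g g∉B))
    where
    D = (B ─ ⁅ e ⁆) ∪ ⁅ y ⁆
    D-basis : IsBasis M d D
    D-basis = D∈I , trans (x∉p⇒∣p∪⁅x⁆∣≡1+∣p∣ (B ─ ⁅ e ⁆) y∉B─e)
                          (trans (sym (x∈p⇒∣p∣≡1+∣p─⁅x⁆∣ e∈B)) ∣B∣≡d)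
    e∉D : e ∉ D
    e∉D e∈D = case x∈p∪q⁻ (B ─ ⁅ e ⁆) ⁅ y ⁆ e∈D of λ where
      (inj₁ e∈B─e) → x∈p─q⇒x∉q B ⁅ e ⁆ e∈B─e (x∈⁅x⁆ e)
      (inj₂ e∈y)   → e∉B₀ (subst (_∈ B₀) (sym (x∈⁅y⁆⇒x≡y y e∈y)) y∈B₀)
    isY : ∀ {h} → ¬ AvoidedWith h → h ∉ B → h ≡ y
    isY {h} ¬h h∉B with h ∈? D
    ... | no  h∉D = ⊥-elim (¬h (D , D-basis , e∉D , h∉D))
    ... | yes h∈D = case x∈p∪q⁻ (B ─ ⁅ e ⁆) ⁅ y ⁆ h∈D of λ where
      (inj₁ h∈B─e) → ⊥-elim (h∉B (p─q⊆p B ⁅ e ⁆ h∈B─e))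
      (inj₂ h∈y)   → x∈⁅y⁆⇒x≡y y h∈y

  basis-missesAtMostOne : ∀ {B f g} → IsBasis M d B → f ∈ Sₑ → g ∈ Sₑ → f ∉ B → g ∉ B → f ≡ g
  basis-missesAtMostOne B-basis f∈Sₑ g∈Sₑ f∉B g∉B with ∈Sₑ⇒InSeries f∈Sₑ | ∈Sₑ⇒InSeries g∈Sₑ
  ... | inj₁ refl | inj₁ refl = refl
  ... | inj₁ refl | inj₂ ¬g   = ⊥-elim (¬g (_ , B-basis , f∉B , g∉B))
  ... | inj₂ ¬f   | inj₁ refl = ⊥-elim (¬f (_ , B-basis , g∉B , f∉B))
  ... | inj₂ ¬f   | inj₂ ¬g   = missedInSeries-unique B-basis ¬f ¬g f∉B g∉B

  -- Extend A to a basis D inside A ∪ B for a basis B ∌ x; then x ∉ D, so D contains all of Sₑ ─ ⁅ x ⁆.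
  isSeriesClass : SeriesClass (Indep M) Sₑ
  isSeriesClass {x} x∈Sₑ {A} {T} T⊆Sₑ─x (A∈I , A#x)
    with B , (B∈I , ∣B∣≡d) , x∉B ← coloopless x
    with D , D∈I , A⊆D , D⊆A∪B , ∣D∣≡∣B∣ ← augment M A∈I B∈I (subst (∣ A ∣ ≤_) (sym ∣B∣≡d) (bounded A A∈I))
    = indep-⊆ M (∪-least A⊆D T⊆D) D∈I , disjoint-∪ A#x (λ t → x∈p─q⇒x∉q Sₑ ⁅ x ⁆ (T⊆Sₑ─x t))
    where
    x∉D : x ∉ D
    x∉D x∈D = case x∈p∪q⁻ A B (D⊆A∪B x∈D) of λ where
      (inj₁ x∈A) → A#x x∈A (x∈⁅x⁆ x)
      (inj₂ x∈B) → x∉B x∈B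
    T⊆D : T ⊆ D
    T⊆D {t} t∈T with t ∈? D
    ... | yes t∈D = t∈D
    ... | no  t∉D = ⊥-elim (x∈p─⁅y⁆⇒x≢y (T⊆Sₑ─x t∈T)
                     (basis-missesAtMostOne (D∈I , trans ∣D∣≡∣B∣ ∣B∣≡d) (p─q⊆p Sₑ ⁅ x ⁆ (T⊆Sₑ─x t∈T))
                                            x∈Sₑ t∉D x∉D))

  s : ℕ
  s = ∣ Sₑ ─ ⁅ e ⁆ ∣

  ∣Sₑ∣≡1+s : ∣ Sₑ ∣ ≡ suc s
  ∣Sₑ∣≡1+s = x∈p⇒∣p∣≡1+∣p─⁅x⁆∣ e∈Sₑ

  deleted : Matroid n
  deleted = deletion M Sₑ

  deleted-rankBounded : RankBounded (Indep deleted) (d ∸ s)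
  deleted-rankBounded A (A∈I , A#Sₑ) =
    ℕ.m+n≤o⇒m≤o∸n ∣ A ∣ (subst (_≤ d) (∣p∪q∣≡∣p∣+∣q∣ A (Sₑ ─ ⁅ e ⁆) (λ a t → A#Sₑ a (p─q⊆p Sₑ ⁅ e ⁆ t)))
                                       (bounded _ (proj₁ (isSeriesClass e∈Sₑ (λ t → t) (A∈I , A#e)))))
    where A#e : Disjoint A ⁅ e ⁆
          A#e a e′ = A#Sₑ a (x∈p⇒⁅x⁆⊆p e∈Sₑ e′)

  deleted-basis : ∀ {B} → IsBasis M d B → e ∉ B → IsBasis deleted (d ∸ s) (B ─ Sₑ)
  deleted-basis {B} (B∈I , ∣B∣≡d) e∉B = (indep-⊆ M (p─q⊆p B Sₑ) B∈I , x∈p─q⇒x∉q B Sₑ) , size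
    where
    Sₑ─e⊆B : Sₑ ─ ⁅ e ⁆ ⊆ B
    Sₑ─e⊆B {z} z∈ with z ∈? B
    ... | yes z∈B = z∈B
    ... | no  z∉B =
      ⊥-elim (x∈p─⁅y⁆⇒x≢y z∈ (basis-missesAtMostOne (B∈I , ∣B∣≡d) (p─q⊆p Sₑ ⁅ e ⁆ z∈) e∈Sₑ z∉B e∉B))
    B─Sₑ≡B─[Sₑ─e] : B ─ Sₑ ≡ B ─ (Sₑ ─ ⁅ e ⁆)
    B─Sₑ≡B─[Sₑ─e] = ⊆-antisym
      (λ z∈ → x∈p∧x∉q⇒x∈p─q (p─q⊆p B Sₑ z∈)
                (λ z∈Sₑ─e → x∈p─q⇒x∉q B Sₑ z∈ (p─q⊆p Sₑ ⁅ e ⁆ z∈Sₑ─e)))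
      (λ z∈ → x∈p∧x∉q⇒x∈p─q (p─q⊆p B _ z∈) (λ z∈Sₑ → x∈p─q⇒x∉q B _ z∈
                (x∈p∧x≢y⇒x∈p-y z∈Sₑ (λ { refl → e∉B (p─q⊆p B _ z∈) }))))
    size : ∣ B ─ Sₑ ∣ ≡ d ∸ s
    size = begin
      ∣ B ─ Sₑ ∣                           ≡⟨ cong ∣_∣ B─Sₑ≡B─[Sₑ─e] ⟩
      ∣ B ─ (Sₑ ─ ⁅ e ⁆) ∣                 ≡⟨ sym (ℕ.m+n∸n≡m _ s) ⟩
      ∣ B ─ (Sₑ ─ ⁅ e ⁆) ∣ ℕ.+ s ∸ s       ≡⟨ cong (_∸ s) (trans (q⊆p⇒∣p─q∣+∣q∣≡∣p∣ B _ Sₑ─e⊆B) ∣B∣≡d) ⟩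
      d ∸ s                                ∎
      where open ≡-Reasoning

  deleted-coloopless : Coloopless deleted (d ∸ s)
  deleted-coloopless g with g ∈? Sₑ | avoidedWith? g
  ... | yes g∈Sₑ | _ = let B , B-basis , e∉B = coloopless e in
    B ─ Sₑ , deleted-basis B-basis e∉B , λ g∈B─Sₑ → x∈p─q⇒x∉q B Sₑ g∈B─Sₑ g∈Sₑ
  ... | no _     | yes (B , B-basis , e∉B , g∉B) =
    B ─ Sₑ , deleted-basis B-basis e∉B , λ g∈B─Sₑ → g∉B (p─q⊆p B Sₑ g∈B─Sₑ)
  ... | no g∉Sₑ  | no ¬avoided = ⊥-elim (g∉Sₑ (x∈tabulate⁺ inSeries? (inj₂ ¬avoided)))

  deleted-fewerNonLoops : Indep M ⁅ e ⁆ → ∣ nonLoops deleted ∣ < ∣ nonLoops M ∣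
  deleted-fewerNonLoops e-nonLoop =
    nonLoops-shrink deleted M proj₁ e-nonLoop (λ (_ , e#Sₑ) → e#Sₑ (x∈⁅x⁆ e) e∈Sₑ)

  module _ (Sₑ∈I : Indep M Sₑ) where

    contracted : Matroid n
    contracted = contraction M Sₑ Sₑ∈I

    contracted-rankBounded : RankBounded (Indep contracted) (d ∸ suc s)
    contracted-rankBounded A A∈I/Sₑ = subst (λ r → ∣ A ∣ ≤ d ∸ r) ∣Sₑ∣≡1+s (/-rankBounded bounded A A∈I/Sₑ)

    contracted-basis : ∀ {D} → IsBasis M d D → Sₑ ⊆ D → IsBasis contracted (d ∸ suc s) (D ─ Sₑ)
    contracted-basis {D} (D∈I , ∣D∣≡d) Sₑ⊆D =
      (x∈p─q⇒x∉q D Sₑ , indep-⊆ M (∪-least (p─q⊆p D Sₑ) Sₑ⊆D) D∈I) , size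
      where
      size : ∣ D ─ Sₑ ∣ ≡ d ∸ suc s
      size = begin
        ∣ D ─ Sₑ ∣                       ≡⟨ sym (ℕ.m+n∸n≡m _ (suc s)) ⟩
        ∣ D ─ Sₑ ∣ ℕ.+ suc s ∸ suc s     ≡⟨ cong (λ r → ∣ D ─ Sₑ ∣ ℕ.+ r ∸ suc s) (sym ∣Sₑ∣≡1+s) ⟩
        ∣ D ─ Sₑ ∣ ℕ.+ ∣ Sₑ ∣ ∸ suc s    ≡⟨ cong (_∸ suc s) (trans (q⊆p⇒∣p─q∣+∣q∣≡∣p∣ D Sₑ Sₑ⊆D) ∣D∣≡d) ⟩
        d ∸ suc s                        ∎
        where open ≡-Reasoning

    contracted-coloopless : Coloopless contracted (d ∸ suc s)
    contracted-coloopless g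
      with B , (B∈I , ∣B∣≡d) , g∉B ← coloopless g
      with D , D∈I , Sₑ⊆D , D⊆Sₑ∪B , ∣D∣≡∣B∣ ←
             augment M Sₑ∈I B∈I (subst (∣ Sₑ ∣ ≤_) (sym ∣B∣≡d) (bounded Sₑ Sₑ∈I))
      = D ─ Sₑ , contracted-basis (D∈I , trans ∣D∣≡∣B∣ ∣B∣≡d) Sₑ⊆D ,
        λ g∈D─Sₑ → case x∈p∪q⁻ Sₑ B (D⊆Sₑ∪B (p─q⊆p D Sₑ g∈D─Sₑ)) of λ where
          (inj₁ g∈Sₑ) → x∈p─q⇒x∉q D Sₑ g∈D─Sₑ g∈Sₑ
          (inj₂ g∈B)  → g∉B g∈B

    contracted-fewerNonLoops : Indep M ⁅ e ⁆ → ∣ nonLoops contracted ∣ < ∣ nonLoops M ∣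
    contracted-fewerNonLoops e-nonLoop =
      nonLoops-shrink contracted M (λ (_ , f∪Sₑ∈I) → indep-⊆ M (p⊆p∪q Sₑ) f∪Sₑ∈I) e-nonLoop
                      (λ (e#Sₑ , _) → e#Sₑ (x∈⁅x⁆ e) e∈Sₑ)

hCoeffs-nonneg : (M : Matroid n) → Acc _<_ ∣ nonLoops M ∣ → ∀ d → RankBounded (Indep M) d → Coloopless M d →
                 ∃ (IsBasis M d) → Nonneg (hCoeffs (indep? M) d)
hCoeffs-nonneg {n} M (acc smaller) d bounded coloopless (B , B∈I , ∣B∣≡d) with any? (nonLoop? M)
... | no allLoops = λ k → sumℤ-map-nonneg _ (allSubsets n) λ A → indicator-nonneg (indep? M A) _ λ A∈I →
        subst (λ i → + 0 ≤ℤ weight d k i) (sym (trans (empty A∈I) (trans (sym (empty B∈I)) ∣B∣≡d)))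
              (weight-diagonal-nonneg d k)
  where
  empty : ∀ {A} → Indep M A → ∣ A ∣ ≡ 0
  empty {A} A∈I = trans (cong ∣_∣ (Empty-unique λ (y , y∈A) → allLoops (y , indep-⊆ M (x∈p⇒⁅x⁆⊆p y∈A) A∈I)))
                        (∣⊥∣≡0 n)
... | yes (e , e-nonLoop) = λ k →
  subst (+ 0 ≤ℤ_) (sym (hCoeffs-seriesClass s (indep? M) d (indep-⊆ M) bounded isSeriesClass ∣Sₑ∣≡1+s k))
        (⊕-nonneg (oddTerms-nonneg (suc s) deleted-nonneg) ([1+x]^-nonneg (suc s) contracted-nonneg) k)
  where
  open SeriesClassOf M d bounded coloopless e
  deleted-nonneg : Nonneg (hCoeffs (indep? deleted) (d ∸ s))
  deleted-nonneg = hCoeffs-nonneg deleted (smaller (deleted-fewerNonLoops e-nonLoop)) (d ∸ s)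
                     deleted-rankBounded deleted-coloopless (map₂ proj₁ (deleted-coloopless e))
  contracted-nonneg : Nonneg (hCoeffs (indep? M /? Sₑ) (d ∸ suc s))
  contracted-nonneg with indep? M Sₑ
  ... | yes Sₑ∈I = hCoeffs-nonneg (contracted Sₑ∈I) (smaller (contracted-fewerNonLoops Sₑ∈I e-nonLoop))
                     (d ∸ suc s) (contracted-rankBounded Sₑ∈I) (contracted-coloopless Sₑ∈I)
                     (map₂ proj₁ (contracted-coloopless Sₑ∈I e))
  ... | no  Sₑ∉I = λ k → sumℤ-map-nonneg _ (allSubsets n) λ A → indicator-nonneg ((indep? M /? Sₑ) A) _
                     λ (_ , A∪Sₑ∈I) → ⊥-elim (Sₑ∉I (indep-⊆ M (q⊆p∪q A Sₑ) A∪Sₑ∈I))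

-- The alternating f-vector sum

length-filter : ∀ {P : X → Set} (P? : Decidable P) xs →
                + length (filter P? xs) ≡ sumℤ (map (λ a → indicator (P? a) (+ 1)) xs)
length-filter P? []       = refl
length-filter P? (x ∷ xs) with P? x
... | yes _ = trans (ℤ.pos-+ 1 (length (filter P? xs))) (cong (_+_ (+ 1)) (length-filter P? xs))
... | no  _ = trans (length-filter P? xs) (sym (ℤ.+-identityˡ _))

*-indicator-1 : (dec : Dec X) → ∀ v → v * indicator dec (+ 1) ≡ indicator dec v
*-indicator-1 (yes _) v = ℤ.*-identityʳ v
*-indicator-1 (no _)  v = ℤ.*-zeroʳ v

sumℤ-applyUpTo-indicator : ∀ (g : ℕ → ℤ) {f a} j m → (∀ t → f t ≡ a ℕ.+ t) → j < a ℕ.+ m →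
                           sumℤ (map (λ i → indicator (j ≟ℕ i) (g i)) (applyUpTo f m))
                           ≡ indicator (a ≤? j) (g j)
sumℤ-applyUpTo-indicator g {a = a} j zero f≗a+ j<a+0 =
  sym (indicator-reject (a ≤? j) (λ a≤j → ℕ.<-irrefl refl (ℕ.≤-<-trans a≤j j<a)) _)
  where j<a = subst (j <_) (ℕ.+-identityʳ a) j<a+0
sumℤ-applyUpTo-indicator g {f} {a} j (suc m) f≗a+ j<a+1+m rewrite trans (f≗a+ 0) (ℕ.+-identityʳ a) =
  trans (cong (_+_ (indicator (j ≟ℕ a) (g a))) rest) (combine (j ≟ℕ a))
  where
  rest : sumℤ (map (λ i → indicator (j ≟ℕ i) (g i)) (applyUpTo (f ∘ suc) m)) ≡ indicator (suc a ≤? j) (g j)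
  rest = sumℤ-applyUpTo-indicator g j m (λ t → trans (f≗a+ (suc t)) (ℕ.+-suc a t))
                                   (subst (j <_) (ℕ.+-suc a m) j<a+1+m)
  combine : (j≟a : Dec (j ≡ a)) →
            indicator j≟a (g a) + indicator (suc a ≤? j) (g j) ≡ indicator (a ≤? j) (g j)
  combine (yes refl) = trans (cong (_+_ (g j)) (indicator-reject (suc j ≤? j) ℕ.1+n≰n _))
                             (trans (ℤ.+-identityʳ (g j)) (sym (indicator-accept (j ≤? j) ℕ.≤-refl (g j))))
  combine (no j≢a)   = trans (ℤ.+-identityˡ _)
                             (indicator-cong (suc a ≤? j) (a ≤? j) ℕ.<⇒≤
                                             (λ a≤j → ℕ.≤∧≢⇒< a≤j (j≢a ∘ sym)) (g j))

sumℤ-range-indicator : ∀ (g : ℕ → ℤ) k d {j} → j ≤ d →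
                       sumℤ (map (λ i → indicator (j ≟ℕ i) (g i)) (range k d)) ≡ indicator (k ≤? j) (g j)
sumℤ-range-indicator g k d {j} j≤d =
  trans (cong (λ is → sumℤ (map (λ i → indicator (j ≟ℕ i) (g i)) is)) (List.map-upTo (k ℕ.+_) (suc d ∸ k)))
        (sumℤ-applyUpTo-indicator g j (suc d ∸ k) (λ _ → refl)
                                  (ℕ.≤-trans (s≤s j≤d) (ℕ.m≤n+m∸n (suc d) k)))

indicator-weight : ∀ d {k i} (k≤?i : Dec (k ≤ i)) → indicator k≤?i (weight d k i) ≡ weight d k i
indicator-weight d         (yes _)  = refl
indicator-weight d {k} {i} (no k≰i) = sym (cong (λ c → + c * (- + 2) ^ (d ∸ i)) (k>n⇒nCk≡0 (ℕ.≰⇒> k≰i)))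

hSum≡hCoeffs : (M : Matroid n) → ∀ d k → RankBounded (Indep M) d → hSum M d k ≡ hCoeffs (indep? M) d k
hSum≡hCoeffs {n} M d k bounded = begin
  sumℤ (map (λ i → w i * + fvec M i) R)
    ≡⟨ cong sumℤ (List.map-cong (λ i → trans (cong (w i *_) (length-filter (Indexed i) L))
                                             (sym (sumℤ-map-*ˡ (w i) _ L))) R) ⟩
  sumℤ (map (λ i → sumℤ (map (λ A → w i * indicator (Indexed i A) (+ 1)) L)) R)
    ≡⟨ cong sumℤ (List.map-cong (λ i → cong sumℤ (List.map-cong (λ A →
         trans (*-indicator-1 (Indexed i A) (w i)) (indicator-× (indep? M A) (∣ A ∣ ≟ℕ i) (w i))) L)) R) ⟩
  sumℤ (map (λ i → sumℤ (map (λ A → indicator (indep? M A) (indicator (∣ A ∣ ≟ℕ i) (w i))) L)) R)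
    ≡⟨ sumℤ-swap (λ i A → indicator (indep? M A) (indicator (∣ A ∣ ≟ℕ i) (w i))) R L ⟩
  ∑ (λ A → sumℤ (map (λ i → indicator (indep? M A) (indicator (∣ A ∣ ≟ℕ i) (w i))) R))
    ≡⟨ cong sumℤ (List.map-cong (λ A → trans (sumℤ-map-indicator (indep? M A) _ R) (single A)) L) ⟩
  hCoeffs (indep? M) d k
    ∎
  where
  open ≡-Reasoning
  L = allSubsets n
  R = range k d
  w = weight d k
  Indexed : ∀ i → Decidable λ A → Indep M A × ∣ A ∣ ≡ i
  Indexed i A = indep? M A ×-dec (∣ A ∣ ≟ℕ i)
  single : ∀ A → indicator (indep? M A) (sumℤ (map (λ i → indicator (∣ A ∣ ≟ℕ i) (w i)) R))
                ≡ indicator (indep? M A) (w ∣ A ∣)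
  single A with indep? M A
  ... | no  _   = refl
  ... | yes A∈I = trans (sumℤ-range-indicator w k d (bounded A A∈I)) (indicator-weight d (k ≤? ∣ A ∣))

theorem0p3 : (n : ℕ) (M : Matroid n) (d : ℕ) → HasRank M d → NoColoops M d →
    (k : ℕ) → k ≤ d → (+ 0) ≤ℤ hSum M d k
theorem0p3 n M d (hasBasis , bounded) noColoops k _ =
  subst (+ 0 ≤ℤ_) (sym (hSum≡hCoeffs M d k bounded))
        (hCoeffs-nonneg M (<-wellFounded _) d bounded (noColoops⇒coloopless M noColoops) hasBasis k)
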